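{- Let $s\in\mathbb{N}$, let $G=(V,E)$ be a finite graph, and let $\varphi$ be an automorphism of $G$ such that (a) $\varphi\circ\varphi=\mathrm{id}_V$ and (b) $\{u,\varphi(u)\}\notin E$ for all $u\in V$. Then ${\rm Nim}(\mathcal{C}_s(G))={\rm Nim}(\mathcal{C}_s(H))$, where $H$ is the induced subgraph of $G$ on the fixed-point set $\{u\in V:\varphi(u)=u\}$.
   Context: Chomp on a finite poset $P$ with global minimum $0$: two players alternately pick an element $x$ of the remaining poset and remove all elements $\ge x$; the player forced to pick $0$ loses. ${\rm Nim}(\{0\})=0$ and ${\rm Nim}(P)=\mathrm{mex}\{{\rm Nim}(P_x) : x\in P\setminus\{0\}\}$, where $P_x$ is $P$ with the up-set of $x$ removed. A clique of $G$ is a set of pairwise adjacent vertices. For $s\in\mathbb{N}$, $\mathcal{C}_s(G)$ is the simplicial complex on $V(G)$ whose faces are the cliques of $G$ of size at most $s$ (including the empty face); it is regarded as a poset under inclusion with minimum the empty face. -}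

module Defs where

open import Data.Nat using (ℕ; zero; suc; _≤ᵇ_; _≡ᵇ_)
open import Data.Bool using (Bool; true; false; not; _∧_; _∨_; if_then_else_)
open import Data.Fin using (Fin)
open import Data.Fin.Properties using (_≟_)
open import Data.Fin.Subset using (Subset; ∣_∣)
open import Data.List using (List; []; _∷_; map; _++_; filterᵇ; length)
open import Data.Bool.ListAction using (all; any)
open import Data.List using (allFin)
open import Data.Vec using (Vec; []; _∷_; lookup; tabulate)
open import Relation.Nullary.Decidable using (⌊_⌋)

mexFrom : List ℕ → ℕ → ℕ → ℕ
mexFrom l zero    k = k
mexFrom l (suc f) k = if any (λ m → m ≡ᵇ k) l then mexFrom l f (suc k) else k

mex : List ℕ → ℕ
mex l = mexFrom l (suc (length l)) 0

allSubsets : (n : ℕ) → List (Subset n)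
allSubsets zero    = [] ∷ []
allSubsets (suc n) = map (false ∷_) (allSubsets n) ++ map (true ∷_) (allSubsets n)

_⇒ᵇ_ : Bool → Bool → Bool
a ⇒ᵇ b = not a ∨ b

_⊆ᵇ_ : {n : ℕ} → Subset n → Subset n → Bool
_⊆ᵇ_ {n} σ τ = all (λ i → lookup σ i ⇒ᵇ lookup τ i) (allFin n)

-- Chomp on a finite poset of faces (subsets of Fin n) ordered by
-- inclusion, whose minimum is the empty face.  A position is the list of
-- remaining elements.
-- The minimum (empty face) is never a legal pick (picking it loses).

isEmptyᵇ : {n : ℕ} → Subset n → Bool
isEmptyᵇ σ = ∣ σ ∣ ≡ᵇ 0

removeUp : {n : ℕ} → Subset n → List (Subset n) → List (Subset n)
removeUp x P = filterᵇ (λ y → not (x ⊆ᵇ y)) P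

-- Nim value with fuel; each move removes at least the picked element,
-- so fuel = length of the position suffices.
nimFuel : {n : ℕ} → ℕ → List (Subset n) → ℕ
nimFuel zero    P = 0
nimFuel (suc k) P =
  mex (map (λ x → nimFuel k (removeUp x P)) (filterᵇ (λ x → not (isEmptyᵇ x)) P))

Nim : {n : ℕ} → List (Subset n) → ℕ
Nim P = nimFuel (length P) P

-- Graphs on vertex set W ⊆ Fin n with boolean adjacency on Fin n.

Adjacency : ℕ → Set
Adjacency n = Fin n → Fin n → Bool

isCliqueᵇ : {n : ℕ} → Subset n → Adjacency n → Subset n → Bool
isCliqueᵇ {n} W adj σ =
  (σ ⊆ᵇ W) ∧
  all (λ i → all (λ j →
         (lookup σ i ∧ lookup σ j ∧ not ⌊ i ≟ j ⌋) ⇒ᵇ adj i j)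
       (allFin n)) (allFin n)

Cs : {n : ℕ} → ℕ → Subset n → Adjacency n → List (Subset n)
Cs {n} s W adj = filterᵇ (λ σ → isCliqueᵇ W adj σ ∧ (∣ σ ∣ ≤ᵇ s)) (allSubsets n)

fullSet : (n : ℕ) → Subset n
fullSet n = tabulate (λ _ → true)

fixSet : {n : ℕ} → (Fin n → Fin n) → Subset n
fixSet φ = tabulate (λ i → ⌊ φ i ≟ i ⌋)

-- Mirror strategy. The involution φ acts on faces by an involutive automorphism of
-- the complex, and no clique contains a non-fixed face together with its mirror image,
-- since a vertex u ≠ φ u of a clique would be adjacent to φ u. Hence a non-fixed move x
-- is answered by φ(x), after which the fixed part of the position is unchanged, while a
-- fixed move acts alike on the position and on its fixed part. By induction on the size
-- of the position, its Nim value equals that of its fixed part; and the fixed faces of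
-- C_s(G) are exactly the cliques of H of size at most s.
module Submission where

open import Defs
open import Data.Bool using (Bool; true; false; T; T?; not; _∧_; if_then_else_)
open import Data.Bool.Properties using (T-∧) renaming (_≟_ to _≟ᵇ_)
open import Data.Bool.ListAction using (all; any)
open import Data.Empty using (⊥-elim)
open import Data.Fin using (Fin; toℕ)
open import Data.Fin.Permutation using (permutation)
open import Data.Fin.Properties using (pigeonhole; toℕ<n) renaming (_≟_ to _≟ᶠ_)
open import Data.Fin.Subset using (Subset; ∣_∣)
open import Data.List using (List; []; _∷_; map; filter; filterᵇ; length; allFin)
import Data.List as List
open import Data.List.Membership.Propositional using (_∈_; _∉_)
open import Data.List.Membership.Propositional.Properties
  using (∈-filter⁺; ∈-filter⁻; ∈-map∘filter⁺; ∈-map∘filter⁻; ∈-map⁺; ∈-++⁺ˡ; ∈-++⁺ʳ)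
open import Data.List.Properties using (filter-all; filter-idem; filter-notAll; filter-≐; length-filter; map-cong-local)
open import Data.List.Relation.Unary.All as All using (All)
open import Data.List.Relation.Unary.All.Properties using (all⁺; all⁻; tabulate⁺; tabulate⁻)
open import Data.List.Relation.Unary.Any as Any using (Any)
open import Data.List.Relation.Unary.Any.Properties using (any⁺; any⁻; lookup-index)
open import Data.Nat using (ℕ; zero; suc; _+_; _≡ᵇ_; _≤ᵇ_; _≤_; _<_; z≤n; s≤s⁻¹)
open import Data.Nat.Properties
  using (≤-refl; <-≤-trans; ≤-<-trans; <-irrefl; <⇒≱; <-cmp; ≮⇒≥; +-suc; +-identityʳ; m≤n⇒m<n∨m≡n; ≡ᵇ⇒≡; ≡⇒≡ᵇ; +-0-commutativeMonoid)
open import Data.Product using (_×_; _,_; proj₁; proj₂; ∃-syntax; swap)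
open import Data.Sum using (inj₁; inj₂)
open import Data.Vec using (Vec; lookup; tabulate; []; _∷_)
open import Data.Vec.Properties using (lookup∘tabulate; tabulate∘lookup; tabulate-cong; ≡-dec)
open import Function using (_∘_; Equivalence)
open import Relation.Binary using (tri<; tri≈; tri>)
open import Relation.Binary.PropositionalEquality using (_≡_; _≢_; refl; sym; trans; cong; subst; subst₂; module ≡-Reasoning)
open import Relation.Nullary using (¬_; yes; no; contradiction)
open import Relation.Nullary.Decidable using (⌊_⌋; toWitness; fromWitness)
open import Relation.Unary using (Pred; Decidable)
open import Relation.Unary.Properties using (_∩?_)
open import Algebra.Properties.CommutativeMonoid.Sum +-0-commutativeMonoid using (sum; sum-cong-≗; sum-permute)

private variable
  n : ℕ
  σ τ x : Subset n
  P : List (Subset n)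

T-ext : ∀ {a b} → (T a → T b) → (T b → T a) → a ≡ b
T-ext {false} {false} _ _ = refl
T-ext {false} {true}  _ g = ⊥-elim (g _)
T-ext {true}  {false} f _ = ⊥-elim (f _)
T-ext {true}  {true}  _ _ = refl

¬T⇒T-not : ∀ {a} → ¬ T a → T (not a)
¬T⇒T-not {false} _  = _
¬T⇒T-not {true}  ¬t = ¬t _

T-not⇒¬T : ∀ {a} → T (not a) → ¬ T a
T-not⇒¬T {false} _ ()

T-⇒ᵇ⁺ : ∀ {a b} → (T a → T b) → T (a ⇒ᵇ b)
T-⇒ᵇ⁺ {false} _ = _
T-⇒ᵇ⁺ {true}  f = f _

T-⇒ᵇ⁻ : ∀ {a b} → T (a ⇒ᵇ b) → T a → T b
T-⇒ᵇ⁻ {true} t _ = t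

T-allFin⁺ : (p : Fin n → Bool) → (∀ i → T (p i)) → T (all p (allFin n))
T-allFin⁺ p t = all⁻ p (tabulate⁺ t)

T-allFin⁻ : (p : Fin n → Bool) → T (all p (allFin n)) → ∀ i → T (p i)
T-allFin⁻ {n} p t = tabulate⁻ (all⁺ p (allFin n) t)

∈⇒T-any : ∀ {v l} → v ∈ l → T (any (_≡ᵇ v) l)
∈⇒T-any {v} v∈l = any⁺ (_≡ᵇ v) (Any.map (λ { refl → ≡⇒≡ᵇ v v refl }) v∈l)

T-any⇒∈ : ∀ {v} l → T (any (_≡ᵇ v) l) → v ∈ l
T-any⇒∈ {v} l t = Any.map (λ {m} m≡ᵇv → sym (≡ᵇ⇒≡ m v m≡ᵇv)) (any⁻ (_≡ᵇ v) l t)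

lookup-ext : {u v : Vec Bool n} → (∀ i → lookup u i ≡ lookup v i) → u ≡ v
lookup-ext {u = u} {v} eq = trans (sym (tabulate∘lookup u)) (trans (tabulate-cong eq) (tabulate∘lookup v))

module _ {A : Set} {p q} {P : Pred A p} {Q : Pred A q} (P? : Decidable P) (Q? : Decidable Q) where

  filter-filter : (xs : List A) → filter P? (filter Q? xs) ≡ filter (Q? ∩? P?) xs
  filter-filter []       = refl
  filter-filter (x ∷ xs) with Q? x
  ... | no _ = filter-filter xs
  ... | yes _ with P? x
  ...   | yes _ = cong (x ∷_) (filter-filter xs)
  ...   | no _  = filter-filter xs

filter-swap : ∀ {A : Set} {p q} {P : Pred A p} {Q : Pred A q} (P? : Decidable P) (Q? : Decidable Q) →
              (xs : List A) → filter P? (filter Q? xs) ≡ filter Q? (filter P? xs)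
filter-swap P? Q? xs = trans (filter-filter P? Q? xs)
  (trans (filter-≐ (Q? ∩? P?) (P? ∩? Q?) (swap , swap) xs) (sym (filter-filter Q? P? xs)))

range⊆⇒≤-length : ∀ {m} l → (∀ v → v < m → v ∈ l) → m ≤ length l
range⊆⇒≤-length {m} l below = ≮⇒≥ λ length<m →
  let (i , j , i<j , same) = pigeonhole length<m position
  in <-irrefl (trans (entry i) (trans (cong (List.lookup l) same) (sym (entry j)))) i<j
  where
  position : Fin m → Fin (length l)
  position i = Any.index (below (toℕ i) (toℕ<n i))
  entry : ∀ i → toℕ i ≡ List.lookup l (position i)
  entry i = lookup-index (below (toℕ i) (toℕ<n i))

mexFrom-below : ∀ l f k v → k ≤ v → v < mexFrom l f k → v ∈ l
mexFrom-below l zero    k v k≤v v<k = contradiction k≤v (<⇒≱ v<k)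
mexFrom-below l (suc f) k v k≤v v<r with any (_≡ᵇ k) l in found
... | false = contradiction k≤v (<⇒≱ v<r)
... | true with m≤n⇒m<n∨m≡n k≤v
...   | inj₁ k<v  = mexFrom-below l f (suc k) v k<v v<r
...   | inj₂ refl = T-any⇒∈ l (subst T (sym found) _)

mexFrom-∈ : ∀ l f k → mexFrom l f k ∈ l → mexFrom l f k ≡ k + f
mexFrom-∈ l zero    k _   = sym (+-identityʳ k)
mexFrom-∈ l (suc f) k r∈l with any (_≡ᵇ k) l in found
... | true  = trans (mexFrom-∈ l f (suc k) r∈l) (sym (+-suc k f))
... | false = contradiction (subst T found (∈⇒T-any r∈l)) (λ ())

mex-below : ∀ l {v} → v < mex l → v ∈ l
mex-below l {v} = mexFrom-below l (suc (length l)) 0 v z≤n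

-- A member of l is only returned once the fuel runs out, which needs all of 0, …, length l in l.
mex-∉ : ∀ l → mex l ∉ l
mex-∉ l mex∈l = <-irrefl refl
  (subst (_≤ length l) (mexFrom-∈ l (suc (length l)) 0 mex∈l) (range⊆⇒≤-length l (λ v → mex-below l)))

mex-unique : ∀ l {m} → (∀ v → v < m → v ∈ l) → m ∉ l → mex l ≡ m
mex-unique l {m} below m∉l with <-cmp (mex l) m
... | tri< mex<m _ _ = contradiction (below (mex l) mex<m) (mex-∉ l)
... | tri≈ _ mex≡m _ = mex≡m
... | tri> _ _ m<mex = contradiction (mex-below l m<mex) m∉l

⊆ᵇ⁺ : (∀ i → T (lookup σ i) → T (lookup τ i)) → T (σ ⊆ᵇ τ)
⊆ᵇ⁺ σ⊆τ = T-allFin⁺ _ (λ i → T-⇒ᵇ⁺ (σ⊆τ i))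

⊆ᵇ⁻ : T (σ ⊆ᵇ τ) → ∀ i → T (lookup σ i) → T (lookup τ i)
⊆ᵇ⁻ t i = T-⇒ᵇ⁻ (T-allFin⁻ _ t i)

⊆ᵇ-refl : T (σ ⊆ᵇ σ)
⊆ᵇ-refl {σ = σ} = ⊆ᵇ⁺ {σ = σ} {σ} (λ _ t → t)

⊆ᵇ-antisym : T (σ ⊆ᵇ τ) → T (τ ⊆ᵇ σ) → σ ≡ τ
⊆ᵇ-antisym {σ = σ} {τ} σ⊆τ τ⊆σ =
  lookup-ext (λ i → T-ext (⊆ᵇ⁻ {σ = σ} {τ} σ⊆τ i) (⊆ᵇ⁻ {σ = τ} {σ} τ⊆σ i))

∈-removeUp⁺ : ∀ x → σ ∈ P → ¬ T (x ⊆ᵇ σ) → σ ∈ removeUp x P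
∈-removeUp⁺ _ σ∈P x⊈σ = ∈-filter⁺ _ σ∈P (¬T⇒T-not x⊈σ)

∈-removeUp⁻ : ∀ x P → σ ∈ removeUp x P → σ ∈ P × ¬ T (x ⊆ᵇ σ)
∈-removeUp⁻ _ _ σ∈ with σ∈P , t ← ∈-filter⁻ _ σ∈ = σ∈P , T-not⇒¬T t

removeUp-shrinks : x ∈ P → length (removeUp x P) < length P
removeUp-shrinks {x = x} {P = P} x∈P =
  filter-notAll _ P (Any.map (λ { refl t → T-not⇒¬T t (⊆ᵇ-refl {σ = x}) }) x∈P)

removeUp-id : ∀ x → All (λ σ → ¬ T (x ⊆ᵇ σ)) P → removeUp x P ≡ P
removeUp-id _ x⊈P = filter-all _ (All.map ¬T⇒T-not x⊈P)

nonempty : Subset n → Bool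
nonempty σ = not (isEmptyᵇ σ)

options : List (Subset n) → List ℕ
options P = map (λ x → Nim (removeUp x P)) (filterᵇ nonempty P)

∈-nonempty⁻ : x ∈ filterᵇ nonempty P → x ∈ P
∈-nonempty⁻ {P = P} x∈ = proj₁ (∈-filter⁻ (T? ∘ nonempty) {xs = P} x∈)

nimFuel-irrelevant : ∀ {k j} (P : List (Subset n)) → length P ≤ k → length P ≤ j →
                     nimFuel k P ≡ nimFuel j P
nimFuel-irrelevant {k = zero}  {zero}  [] _   _   = refl
nimFuel-irrelevant {k = zero}  {suc j} [] _   _   = refl
nimFuel-irrelevant {k = suc k} {zero}  [] _   _   = refl
nimFuel-irrelevant {k = suc k} {suc j} P  P≤k P≤j = cong mex (map-cong-local (All.tabulate sameOption))
  where
  sameOption : ∀ {x} → x ∈ filterᵇ nonempty P → nimFuel k (removeUp x P) ≡ nimFuel j (removeUp x P)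
  sameOption {x} x∈ = nimFuel-irrelevant (removeUp x P)
    (s≤s⁻¹ (<-≤-trans (removeUp-shrinks (∈-nonempty⁻ {P = P} x∈)) P≤k))
    (s≤s⁻¹ (<-≤-trans (removeUp-shrinks (∈-nonempty⁻ {P = P} x∈)) P≤j))

Nim-unfold : (P : List (Subset n)) → Nim P ≡ mex (options P)
Nim-unfold []      = refl
Nim-unfold (σ ∷ P) = cong mex (map-cong-local (All.tabulate fuelSuffices))
  where
  fuelSuffices : ∀ {x} → x ∈ filterᵇ nonempty (σ ∷ P) →
                 nimFuel (length P) (removeUp x (σ ∷ P)) ≡ Nim (removeUp x (σ ∷ P))
  fuelSuffices {x} x∈ =
    nimFuel-irrelevant (removeUp x (σ ∷ P)) (s≤s⁻¹ (removeUp-shrinks (∈-nonempty⁻ {P = σ ∷ P} x∈))) ≤-refl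

∈-options⁺ : x ∈ P → T (nonempty x) → Nim (removeUp x P) ∈ options P
∈-options⁺ {P = P} x∈P x≢∅ =
  ∈-map∘filter⁺ (λ x → Nim (removeUp x P)) (T? ∘ nonempty) (_ , x∈P , refl , x≢∅)

∈-options⁻ : ∀ {v} → v ∈ options P → ∃[ x ] x ∈ P × v ≡ Nim (removeUp x P) × T (nonempty x)
∈-options⁻ {P = P} = ∈-map∘filter⁻ (λ x → Nim (removeUp x P)) (T? ∘ nonempty)

Nim-≢-option : x ∈ P → T (nonempty x) → Nim (removeUp x P) ≢ Nim P
Nim-≢-option {P = P} x∈P x≢∅ same =
  mex-∉ (options P) (subst (_∈ options P) (trans same (Nim-unfold P)) (∈-options⁺ x∈P x≢∅))

module Mirror {n : ℕ} (ψ : Subset n → Subset n)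
  (ψ-involutive : ∀ σ → ψ (ψ σ) ≡ σ)
  (ψ-mono : ∀ {σ τ} → T (σ ⊆ᵇ τ) → T (ψ σ ⊆ᵇ ψ τ))
  (ψ-nonempty : ∀ σ → nonempty (ψ σ) ≡ nonempty σ)
  where

  Fixed : Pred (Subset n) _
  Fixed σ = ψ σ ≡ σ

  Fixed? : Decidable Fixed
  Fixed? σ = ≡-dec _≟ᵇ_ (ψ σ) σ

  fixedPart : List (Subset n) → List (Subset n)
  fixedPart = filter Fixed?

  Closed : List (Subset n) → Set
  Closed P = ∀ {σ} → σ ∈ P → ψ σ ∈ P

  Separated : List (Subset n) → Set
  Separated P = ∀ {σ τ} → τ ∈ P → T (σ ⊆ᵇ τ) → T (ψ σ ⊆ᵇ τ) → Fixed σ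

  ⊆ᵇ-ψʳ : ∀ {σ τ} → T (σ ⊆ᵇ ψ τ) → T (ψ σ ⊆ᵇ τ)
  ⊆ᵇ-ψʳ {σ} {τ} t = subst (λ ρ → T (ψ σ ⊆ᵇ ρ)) (ψ-involutive τ) (ψ-mono t)

  ⊆ᵇ-ψˡ : ∀ {σ τ} → T (ψ σ ⊆ᵇ τ) → T (σ ⊆ᵇ ψ τ)
  ⊆ᵇ-ψˡ {σ} {τ} t = subst (λ ρ → T (ρ ⊆ᵇ ψ τ)) (ψ-involutive σ) (ψ-mono t)

  fixed-if-⊆ᵇ-ψ : ∀ {σ} → T (σ ⊆ᵇ ψ σ) → Fixed σ
  fixed-if-⊆ᵇ-ψ {σ} t = ⊆ᵇ-antisym {σ = ψ σ} {σ} (⊆ᵇ-ψʳ t) t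

  removeUpMirrored : Subset n → List (Subset n) → List (Subset n)
  removeUpMirrored x P = removeUp (ψ x) (removeUp x P)

  ∈-removeUpMirrored⁻ : ∀ x P {σ} → σ ∈ removeUpMirrored x P →
                        σ ∈ P × ¬ T (x ⊆ᵇ σ) × ¬ T (ψ x ⊆ᵇ σ)
  ∈-removeUpMirrored⁻ x P σ∈ with σ∈′ , ψx⊈σ ← ∈-removeUp⁻ (ψ x) (removeUp x P) σ∈
                               with σ∈P , x⊈σ ← ∈-removeUp⁻ x P σ∈′ = σ∈P , x⊈σ , ψx⊈σ

  ψ-mono⁻ : ∀ {σ τ} → T (ψ σ ⊆ᵇ ψ τ) → T (σ ⊆ᵇ τ)
  ψ-mono⁻ {σ} {τ} t = subst₂ (λ ρ ρ′ → T (ρ ⊆ᵇ ρ′)) (ψ-involutive σ) (ψ-involutive τ) (ψ-mono t)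

  removeUpMirrored-closed : ∀ x {P} → Closed P → Closed (removeUpMirrored x P)
  removeUpMirrored-closed x {P} closed {σ} σ∈ with σ∈P , x⊈σ , ψx⊈σ ← ∈-removeUpMirrored⁻ x P σ∈ =
    ∈-removeUp⁺ (ψ x) (∈-removeUp⁺ x (closed σ∈P) (ψx⊈σ ∘ ⊆ᵇ-ψʳ {x} {σ})) (x⊈σ ∘ ψ-mono⁻ {x} {σ})

  removeUpMirrored-separated : ∀ x {P} → Separated P → Separated (removeUpMirrored x P)
  removeUpMirrored-separated x {P} separated τ∈ = separated (proj₁ (∈-removeUpMirrored⁻ x P τ∈))

  removeUpMirrored-shrinks : ∀ {x P} → x ∈ P → length (removeUpMirrored x P) < length P
  removeUpMirrored-shrinks {x} {P} x∈P = ≤-<-trans (length-filter _ (removeUp x P)) (removeUp-shrinks x∈P)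

  fixedPart-removeUpMirrored : ∀ x P → fixedPart (removeUpMirrored x P) ≡ removeUpMirrored x (fixedPart P)
  fixedPart-removeUpMirrored x P = begin
    filter Fixed? (removeUp (ψ x) (removeUp x P))   ≡⟨ filter-swap Fixed? _ (removeUp x P) ⟩
    removeUp (ψ x) (filter Fixed? (removeUp x P))   ≡⟨ cong (removeUp (ψ x)) (filter-swap Fixed? _ P) ⟩
    removeUp (ψ x) (removeUp x (filter Fixed? P))   ∎
    where open ≡-Reasoning

  removeUpMirrored-fixed : ∀ {x} P → Fixed x → removeUpMirrored x P ≡ removeUp x P
  removeUpMirrored-fixed {x} P ψx≡x =
    trans (cong (λ y → removeUp y (removeUp x P)) ψx≡x) (filter-idem _ P)

  removeUpMirrored-unfixed : ∀ {x} P → Separated P → ¬ Fixed x → removeUpMirrored x (fixedPart P) ≡ fixedPart P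
  removeUpMirrored-unfixed {x} P separated unfixed = begin
    removeUp (ψ x) (removeUp x (fixedPart P))  ≡⟨ cong (removeUp (ψ x)) (removeUp-id x (All.tabulate x⊈)) ⟩
    removeUp (ψ x) (fixedPart P)               ≡⟨ removeUp-id (ψ x) (All.tabulate ψx⊈) ⟩
    fixedPart P                                ∎
    where
    open ≡-Reasoning
    x⊈ : ∀ {σ} → σ ∈ fixedPart P → ¬ T (x ⊆ᵇ σ)
    x⊈ {σ} σ∈ x⊆σ with σ∈P , ψσ≡σ ← ∈-filter⁻ Fixed? σ∈ =
      unfixed (separated σ∈P x⊆σ (subst (λ ρ → T (ψ x ⊆ᵇ ρ)) ψσ≡σ (ψ-mono x⊆σ)))
    ψx⊈ : ∀ {σ} → σ ∈ fixedPart P → ¬ T (ψ x ⊆ᵇ σ)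
    ψx⊈ {σ} σ∈ ψx⊆σ with σ∈P , ψσ≡σ ← ∈-filter⁻ Fixed? σ∈ =
      unfixed (separated σ∈P (subst (λ ρ → T (x ⊆ᵇ ρ)) ψσ≡σ (⊆ᵇ-ψˡ ψx⊆σ)) ψx⊆σ)

  Nim-fixedPart-step : ∀ {P} → Closed P → Separated P →
    (∀ {x} → x ∈ P → Nim (removeUpMirrored x P) ≡ Nim (removeUpMirrored x (fixedPart P))) →
    Nim P ≡ Nim (fixedPart P)
  Nim-fixedPart-step {P} closed separated afterMirroredMoves =
    trans (Nim-unfold P) (mex-unique (options P) realised notRealised)
    where
    R = fixedPart P

    fixedMove : ∀ {x} → x ∈ P → Fixed x → Nim (removeUp x P) ≡ Nim (removeUp x R)
    fixedMove {x} x∈P ψx≡x = begin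
      Nim (removeUp x P)           ≡⟨ cong Nim (removeUpMirrored-fixed P ψx≡x) ⟨
      Nim (removeUpMirrored x P)   ≡⟨ afterMirroredMoves x∈P ⟩
      Nim (removeUpMirrored x R)   ≡⟨ cong Nim (removeUpMirrored-fixed R ψx≡x) ⟩
      Nim (removeUp x R)           ∎
      where open ≡-Reasoning

    mirrorReply : ∀ {x} → x ∈ P → ¬ Fixed x → Nim (removeUp (ψ x) (removeUp x P)) ≡ Nim R
    mirrorReply {x} x∈P unfixed =
      trans (afterMirroredMoves x∈P) (cong Nim (removeUpMirrored-unfixed P separated unfixed))

    realised : ∀ v → v < Nim R → v ∈ options P
    realised v v<NimR
      with x , x∈R , v≡ , x≢∅ ← ∈-options⁻ {P = R} (mex-below (options R) (subst (v <_) (Nim-unfold R) v<NimR))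
      with x∈P , ψx≡x ← ∈-filter⁻ Fixed? x∈R =
      subst (_∈ options P) (trans (fixedMove x∈P ψx≡x) (sym v≡)) (∈-options⁺ x∈P x≢∅)

    notRealised : Nim R ∉ options P
    notRealised NimR∈ with x , x∈P , NimR≡ , x≢∅ ← ∈-options⁻ {P = P} NimR∈ with Fixed? x
    ... | yes ψx≡x = Nim-≢-option (∈-filter⁺ Fixed? x∈P ψx≡x) x≢∅
                       (trans (sym (fixedMove x∈P ψx≡x)) (sym NimR≡))
    ... | no unfixed = Nim-≢-option ψx∈ (subst T (sym (ψ-nonempty x)) x≢∅)
                         (trans (mirrorReply x∈P unfixed) NimR≡)
      where
      ψx∈ : ψ x ∈ removeUp x P
      ψx∈ = ∈-removeUp⁺ x (closed x∈P) (unfixed ∘ fixed-if-⊆ᵇ-ψ)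

  Nim-fixedPart : ∀ {P} → Closed P → Separated P → Nim P ≡ Nim (fixedPart P)
  Nim-fixedPart {P} = go (length P) P ≤-refl
    where
    go : ∀ k P → length P ≤ k → Closed P → Separated P → Nim P ≡ Nim (fixedPart P)
    go zero    []  _   _      _         = refl
    go (suc k) P   P≤k closed separated = Nim-fixedPart-step closed separated λ {x} x∈P → trans
      (go k (removeUpMirrored x P) (s≤s⁻¹ (<-≤-trans (removeUpMirrored-shrinks x∈P) P≤k))
          (removeUpMirrored-closed x closed) (removeUpMirrored-separated x separated))
      (cong Nim (fixedPart-removeUpMirrored x P))

-- The preimage of σ under φ; for an involution φ this is also the image.
relabel : (Fin n → Fin n) → Subset n → Subset n
relabel φ σ = tabulate (lookup σ ∘ φ)

lookup-relabel : ∀ (φ : Fin n → Fin n) σ i → lookup (relabel φ σ) i ≡ lookup σ (φ i)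
lookup-relabel φ σ = lookup∘tabulate (lookup σ ∘ φ)

relabel-mono : ∀ {φ : Fin n → Fin n} {σ τ} → T (σ ⊆ᵇ τ) → T (relabel φ σ ⊆ᵇ relabel φ τ)
relabel-mono {φ = φ} {σ} {τ} σ⊆τ = ⊆ᵇ⁺ {σ = relabel φ σ} {relabel φ τ} λ i →
  subst T (sym (lookup-relabel φ τ i)) ∘ ⊆ᵇ⁻ {σ = σ} {τ} σ⊆τ (φ i) ∘ subst T (lookup-relabel φ σ i)

∣σ∣≡sum : (σ : Subset n) → ∣ σ ∣ ≡ sum (λ i → if lookup σ i then 1 else 0)
∣σ∣≡sum []          = refl
∣σ∣≡sum (true  ∷ σ) = cong suc (∣σ∣≡sum σ)
∣σ∣≡sum (false ∷ σ) = ∣σ∣≡sum σ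

module _ {φ : Fin n → Fin n} (φ-involutive : ∀ u → φ (φ u) ≡ u) where

  relabel-involutive : ∀ σ → relabel φ (relabel φ σ) ≡ σ
  relabel-involutive σ = lookup-ext λ i → begin
    lookup (relabel φ (relabel φ σ)) i  ≡⟨ lookup-relabel φ (relabel φ σ) i ⟩
    lookup (relabel φ σ) (φ i)          ≡⟨ lookup-relabel φ σ (φ i) ⟩
    lookup σ (φ (φ i))                  ≡⟨ cong (lookup σ) (φ-involutive i) ⟩
    lookup σ i                          ∎
    where open ≡-Reasoning

  ∣relabel∣ : ∀ σ → ∣ relabel φ σ ∣ ≡ ∣ σ ∣
  ∣relabel∣ σ = begin
    ∣ relabel φ σ ∣                                       ≡⟨ ∣σ∣≡sum (relabel φ σ) ⟩
    sum (λ i → if lookup (relabel φ σ) i then 1 else 0)  ≡⟨ sum-cong-≗ (λ i → cong (if_then 1 else 0) (lookup-relabel φ σ i)) ⟩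
    sum (λ i → if lookup σ (φ i) then 1 else 0)          ≡⟨ sum-permute (λ i → if lookup σ i then 1 else 0) (permutation φ φ φ-involutive φ-involutive) ⟨
    sum (λ i → if lookup σ i then 1 else 0)              ≡⟨ ∣σ∣≡sum σ ⟨
    ∣ σ ∣                                                 ∎
    where open ≡-Reasoning

  relabel-identity-on : ∀ {σ} → (∀ u → T (lookup σ u) → φ u ≡ u) → relabel φ σ ≡ σ
  relabel-identity-on {σ} fixes = lookup-ext λ u → trans (lookup-relabel φ σ u) (T-ext (from u) (to u))
    where
    to : ∀ u → T (lookup σ u) → T (lookup σ (φ u))
    to u σu = subst (T ∘ lookup σ) (sym (fixes u σu)) σu
    from : ∀ u → T (lookup σ (φ u)) → T (lookup σ u)
    from u σφu = subst (T ∘ lookup σ) (trans (sym (fixes (φ u) σφu)) (φ-involutive u)) σφu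

PairwiseAdjacent : Adjacency n → Subset n → Set
PairwiseAdjacent adj σ = ∀ i j → T (lookup σ i) → T (lookup σ j) → i ≢ j → T (adj i j)

module _ {W : Subset n} {adj : Adjacency n} {σ : Subset n} where

  private
    adjacentIfDistinct : Fin n → Fin n → Bool
    adjacentIfDistinct i j = (lookup σ i ∧ lookup σ j ∧ not ⌊ i ≟ᶠ j ⌋) ⇒ᵇ adj i j

  isCliqueᵇ⁺ : T (σ ⊆ᵇ W) → PairwiseAdjacent adj σ → T (isCliqueᵇ W adj σ)
  isCliqueᵇ⁺ σ⊆W pairwise = Equivalence.from T-∧ (σ⊆W ,
    T-allFin⁺ (λ i → all (adjacentIfDistinct i) (allFin n)) λ i →
    T-allFin⁺ (adjacentIfDistinct i) λ j → T-⇒ᵇ⁺ λ t →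
      let σi , t′ = Equivalence.to T-∧ t
          σj , i≢j = Equivalence.to T-∧ t′
      in pairwise i j σi σj (T-not⇒¬T i≢j ∘ fromWitness))

  isCliqueᵇ⁻ : T (isCliqueᵇ W adj σ) → T (σ ⊆ᵇ W) × PairwiseAdjacent adj σ
  isCliqueᵇ⁻ t with σ⊆W , pairwise ← Equivalence.to T-∧ t =
    σ⊆W , λ i j σi σj i≢j →
      T-⇒ᵇ⁻ (T-allFin⁻ (adjacentIfDistinct i) (T-allFin⁻ (λ i → all (adjacentIfDistinct i) (allFin n)) pairwise i) j)
        (Equivalence.from T-∧ (σi , Equivalence.from T-∧ (σj , ¬T⇒T-not (i≢j ∘ toWitness))))

PairwiseAdjacent-relabel : ∀ {adj : Adjacency n} {φ : Fin n → Fin n} {σ} → (∀ u → φ (φ u) ≡ u) →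
  (∀ u v → adj (φ u) (φ v) ≡ adj u v) → PairwiseAdjacent adj σ → PairwiseAdjacent adj (relabel φ σ)
PairwiseAdjacent-relabel {adj = adj} {φ} {σ} φ-involutive φ-automorphism pairwise i j σi σj i≢j =
  subst T (φ-automorphism i j)
    (pairwise (φ i) (φ j) (subst T (lookup-relabel φ σ i) σi) (subst T (lookup-relabel φ σ j) σj)
      (λ φi≡φj → i≢j (trans (sym (φ-involutive i)) (trans (cong φ φi≡φj) (φ-involutive j)))))

PairwiseAdjacent⇒φ-fixed : ∀ {adj : Adjacency n} {φ : Fin n → Fin n} {σ} → (∀ u → adj u (φ u) ≡ false) →
  PairwiseAdjacent adj σ → ∀ u → T (lookup σ u) → T (lookup σ (φ u)) → φ u ≡ u
PairwiseAdjacent⇒φ-fixed {φ = φ} nonadjacent pairwise u σu σφu with φ u ≟ᶠ u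
... | yes φu≡u = φu≡u
... | no  φu≢u = ⊥-elim (subst T (nonadjacent u) (pairwise u (φ u) σu σφu (φu≢u ∘ sym)))

∈-allSubsets : (σ : Subset n) → σ ∈ allSubsets n
∈-allSubsets []          = Any.here refl
∈-allSubsets {suc n} (false ∷ σ) = ∈-++⁺ˡ (∈-map⁺ (false ∷_) (∈-allSubsets σ))
∈-allSubsets {suc n} (true  ∷ σ) = ∈-++⁺ʳ (map (false ∷_) (allSubsets n)) (∈-map⁺ (true ∷_) (∈-allSubsets σ))

isSmallCliqueᵇ : ℕ → Subset n → Adjacency n → Subset n → Bool
isSmallCliqueᵇ s W adj σ = isCliqueᵇ W adj σ ∧ (∣ σ ∣ ≤ᵇ s)

module _ {s : ℕ} {W : Subset n} {adj : Adjacency n} where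

  isSmallCliqueᵇ⁺ : ∀ {σ} → T (σ ⊆ᵇ W) → PairwiseAdjacent adj σ → T (∣ σ ∣ ≤ᵇ s) → T (isSmallCliqueᵇ s W adj σ)
  isSmallCliqueᵇ⁺ {σ} σ⊆W pairwise small =
    Equivalence.from T-∧ (isCliqueᵇ⁺ {W = W} {adj} {σ} σ⊆W pairwise , small)

  isSmallCliqueᵇ⁻ : ∀ {σ} → T (isSmallCliqueᵇ s W adj σ) → T (σ ⊆ᵇ W) × PairwiseAdjacent adj σ × T (∣ σ ∣ ≤ᵇ s)
  isSmallCliqueᵇ⁻ {σ} t with clique , small ← Equivalence.to T-∧ t
                        with σ⊆W , pairwise ← isCliqueᵇ⁻ {W = W} {adj} {σ} clique = σ⊆W , pairwise , small

  ∈-Cs⁺ : ∀ {σ} → T (isSmallCliqueᵇ s W adj σ) → σ ∈ Cs s W adj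
  ∈-Cs⁺ {σ} = ∈-filter⁺ (T? ∘ isSmallCliqueᵇ s W adj) (∈-allSubsets σ)

  ∈-Cs⁻ : ∀ {σ} → σ ∈ Cs s W adj → T (isSmallCliqueᵇ s W adj σ)
  ∈-Cs⁻ σ∈ = proj₂ (∈-filter⁻ (T? ∘ isSmallCliqueᵇ s W adj) {xs = allSubsets n} σ∈)

module CliqueComplex (s : ℕ) {n : ℕ} (adj : Adjacency n) {φ : Fin n → Fin n}
  (φ-automorphism : ∀ u v → adj (φ u) (φ v) ≡ adj u v)
  (φ-involutive : ∀ u → φ (φ u) ≡ u)
  (φ-nonadjacent : ∀ u → adj u (φ u) ≡ false)
  where

  open Mirror (relabel φ) (relabel-involutive φ-involutive) (λ {σ} {τ} → relabel-mono {φ = φ} {σ} {τ})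
    (λ σ → cong (λ k → not (k ≡ᵇ 0)) (∣relabel∣ φ-involutive σ)) public

  ⊆ᵇ-fullSet : ∀ σ → T (σ ⊆ᵇ fullSet n)
  ⊆ᵇ-fullSet σ = ⊆ᵇ⁺ {σ = σ} {fullSet n} λ i _ → subst T (sym (lookup∘tabulate _ i)) _

  fixSet⁺ : ∀ {u} → φ u ≡ u → T (lookup (fixSet φ) u)
  fixSet⁺ {u} φu≡u = subst T (sym (lookup∘tabulate _ u)) (fromWitness φu≡u)

  fixSet⁻ : ∀ {u} → T (lookup (fixSet φ) u) → φ u ≡ u
  fixSet⁻ {u} t = toWitness (subst T (lookup∘tabulate (λ i → ⌊ φ i ≟ᶠ i ⌋) u) t)

  Cs-closed : Closed (Cs s (fullSet n) adj)
  Cs-closed {σ} σ∈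
    with _ , pairwise , small ← isSmallCliqueᵇ⁻ {W = fullSet n} {σ = σ} (∈-Cs⁻ {W = fullSet n} σ∈) =
    ∈-Cs⁺ {W = fullSet n} (isSmallCliqueᵇ⁺ {W = fullSet n} {σ = relabel φ σ} (⊆ᵇ-fullSet (relabel φ σ))
            (PairwiseAdjacent-relabel {σ = σ} φ-involutive φ-automorphism pairwise)
            (subst (λ k → T (k ≤ᵇ s)) (sym (∣relabel∣ φ-involutive σ)) small))

  Cs-separated : ∀ {W} → Separated (Cs s W adj)
  Cs-separated {W} {σ} {τ} τ∈ σ⊆τ φσ⊆τ = relabel-identity-on φ-involutive λ u σu →
    PairwiseAdjacent⇒φ-fixed {σ = τ} φ-nonadjacent pairwise u (⊆ᵇ⁻ {σ = σ} {τ} σ⊆τ u σu)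
      (⊆ᵇ⁻ {σ = relabel φ σ} {τ} φσ⊆τ (φ u) (subst T (sym (relabel-at-φ u)) σu))
    where
    pairwise : PairwiseAdjacent adj τ
    pairwise = proj₁ (proj₂ (isSmallCliqueᵇ⁻ {W = W} {σ = τ} (∈-Cs⁻ {W = W} τ∈)))
    relabel-at-φ : ∀ u → lookup (relabel φ σ) (φ u) ≡ lookup σ u
    relabel-at-φ u = trans (lookup-relabel φ σ (φ u)) (cong (lookup σ) (φ-involutive u))

  fixedPart-Cs : fixedPart (Cs s (fullSet n) adj) ≡ Cs s (fixSet φ) adj
  fixedPart-Cs = trans (filter-filter Fixed? (T? ∘ isSmallCliqueᵇ s (fullSet n) adj) (allSubsets n))
    (filter-≐ (T? ∘ isSmallCliqueᵇ s (fullSet n) adj ∩? Fixed?) (T? ∘ isSmallCliqueᵇ s (fixSet φ) adj) (to , from) (allSubsets n))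
    where
    to : ∀ {σ} → T (isSmallCliqueᵇ s (fullSet n) adj σ) × Fixed σ → T (isSmallCliqueᵇ s (fixSet φ) adj σ)
    to {σ} (t , fixed) with _ , pairwise , small ← isSmallCliqueᵇ⁻ {W = fullSet n} {σ = σ} t =
      isSmallCliqueᵇ⁺ {W = fixSet φ} {σ = σ} (⊆ᵇ⁺ {σ = σ} {fixSet φ} λ u σu →
        fixSet⁺ (PairwiseAdjacent⇒φ-fixed {σ = σ} φ-nonadjacent pairwise u σu
          (subst T (trans (cong (λ ρ → lookup ρ u) (sym fixed)) (lookup-relabel φ σ u)) σu)))
        pairwise small

    from : ∀ {σ} → T (isSmallCliqueᵇ s (fixSet φ) adj σ) → T (isSmallCliqueᵇ s (fullSet n) adj σ) × Fixed σ
    from {σ} t with σ⊆fixSet , pairwise , small ← isSmallCliqueᵇ⁻ {W = fixSet φ} {σ = σ} t =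
      isSmallCliqueᵇ⁺ {W = fullSet n} {σ = σ} (⊆ᵇ-fullSet σ) pairwise small ,
      relabel-identity-on φ-involutive (λ u σu → fixSet⁻ (⊆ᵇ⁻ {σ = σ} {fixSet φ} σ⊆fixSet u σu))

lemma2p11 : (s n : ℕ) (adj : Adjacency n)
    → (∀ u v → adj u v ≡ adj v u)
    → (∀ u → adj u u ≡ false)
    → (φ : Fin n → Fin n)
    → (∀ u v → adj (φ u) (φ v) ≡ adj u v)
    → (∀ u → φ (φ u) ≡ u)
    → (∀ u → adj u (φ u) ≡ false)
    → Nim (Cs s (fullSet n) adj) ≡ Nim (Cs s (fixSet φ) adj)
lemma2p11 s n adj _ _ φ φ-automorphism φ-involutive φ-nonadjacent = begin
  Nim (Cs s (fullSet n) adj)              ≡⟨ Nim-fixedPart Cs-closed (Cs-separated {W = fullSet n}) ⟩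
  Nim (fixedPart (Cs s (fullSet n) adj))  ≡⟨ cong Nim fixedPart-Cs ⟩
  Nim (Cs s (fixSet φ) adj)               ∎
  where
  open ≡-Reasoning
  open CliqueComplex s adj φ-automorphism φ-involutive φ-nonadjacent
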